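{- Let $(a_i)_{i\ge 0}$ and $(b_i)_{i\ge 0}$ be sequences of real numbers with $b_0=a_0$, and let $t(i,j)$, $0\le j\le i$, be the zero-sum triangle with these boundaries (defined in the context). Define, for $i\ge 0$, $$s_0(i)=\sum_{k=0}^{i}t(i,k)a_k,\qquad s_1(i)=\sum_{k=0}^{i}t(i,k)a_{k+1},\qquad s_{ -1}(i)=\sum_{k=1}^{i}t(i,k)a_{k-1}.$$ Then $s_0(0)=a_0^2$, $s_1(0)=a_0a_1$, $s_{ -1}(1)=a_0b_1$, and $$\begin{aligned} s_{ -1}(i)&=a_{i-1}\{b_{i-1}+b_i\}-s_{ -1}(i-1)-s_0(i-1) && (i\ge 2),\\ s_0(i)&=a_0\{a_{i-1}+a_i\}+a_i\{b_{i-1}+b_i\}-s_0(i-1)-s_1(i-1) && (i\ge 1),\\ s_0(i)&=a_i\{b_i+b_{i+1}\}-s_{ -1}(i)-s_{ -1}(i+1) && (i\ge 1),\\ s_1(i)&=a_0\{a_i+a_{i+1}\}+a_{i+1}\{b_i+b_{i+1}\}-s_0(i)-s_0(i+1) && (i\ge 1). \end{aligned}$$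
   Context: Zero-sum triangle: given sequences $(a_i)_{i\ge0}$, $(b_i)_{i\ge0}$ with $b_0=a_0$, define numbers $t(i,j)$ for integers $0\le j\le i$ by $t(i,0)=a_i$ for $i\ge 0$, $t(i,i)=b_i$ for $i\ge 1$, and for $0<j<i$ by the zero-sum rule $t(i,j)+t(i-1,j-1)+t(i-1,j)=0$, i.e. $t(i,j)=-t(i-1,j-1)-t(i-1,j)$. -}

module Defs where

open import Data.Nat using (ℕ; zero; suc; _<?_)
open import Data.Nat.Properties using (_≟_)
open import Relation.Nullary using (yes; no)
open import Algebra.Bundles using (CommutativeRing)

module ZeroSum {c ℓ} (R : CommutativeRing c ℓ) (a b : ℕ → CommutativeRing.Carrier R) where
  open CommutativeRing R

  -- t i j for 0 ≤ j ≤ i; values outside that range are set to 0 and never used.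
  t : ℕ → ℕ → Carrier
  t i zero = a i
  t zero (suc j) = 0#
  t (suc i) (suc j) with suc j ≟ suc i
  ... | yes _ = b (suc i)
  ... | no _ with suc j <? suc i
  ...   | yes _ = - (t i j + t i (suc j))
  ...   | no _ = 0#

  Σ< : ℕ → (ℕ → Carrier) → Carrier
  Σ< zero f = 0#
  Σ< (suc n) f = Σ< n f + f n

  s₀ : ℕ → Carrier
  s₀ i = Σ< (suc i) (λ k → t i k * a k)

  s₁ : ℕ → Carrier
  s₁ i = Σ< (suc i) (λ k → t i k * a (suc k))

  -- s₋₁(i) = Σ_{k=1}^{i} t(i,k) a_{k-1}   (reindexed k ↦ k+1)
  s₋₁ : ℕ → Carrier
  s₋₁ i = Σ< i (λ k → t i (suc k) * a k)

-- Away from the boundary every entry of row i+1 cancels the two entries of row i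
-- above it, so for any weight sequence w the sum over k of
-- (t(i+1,k+1) + t(i,k) + t(i,k+1)) w_k collapses to the diagonal entries
-- (b_i + b_{i+1}) w_i. With w = a this is the recurrence for s₋₁; with w = a∘suc it is
-- the recurrence for s₀ once the first column t(i,0) = a_i is split off from s₀,
-- which contributes a_0 (a_i + a_{i+1}). Each of the two recurrences, solved for a
-- different summand, gives two of the stated identities.
module Submission where

open import Defs
open import Data.Nat using (ℕ; zero; suc; _≤_; _∸_; _<_; _<?_; s≤s; pred)
open import Data.Nat.Properties using (_≟_; <-irrefl; n<1+n; m<n⇒m<1+n)
open import Data.Product using (_×_; _,_)
open import Data.Empty using (⊥-elim)
open import Relation.Nullary using (yes; no)
open import Relation.Binary.PropositionalEquality as ≡ using (_≡_)
open import Algebra.Bundles using (CommutativeRing)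
import Algebra.Properties.Ring as RingProperties
import Algebra.Properties.CommutativeSemigroup as CommutativeSemigroupProperties
import Algebra.Solver.CommutativeMonoid as CommutativeMonoidSolver
import Relation.Binary.Reasoning.Setoid as SetoidReasoning

module ZeroSumProperties {c ℓ} (R : CommutativeRing c ℓ) (a b : ℕ → CommutativeRing.Carrier R) where
  open CommutativeRing R
  open ZeroSum R a b
  open RingProperties ring using (-‿distribˡ-*; //-rightDividesʳ)
  open CommutativeSemigroupProperties +-commutativeSemigroup using (x∙yz≈y∙xz)
  open CommutativeMonoidSolver +-commutativeMonoid using (solve; _⊕_; _⊜_)
  open SetoidReasoning setoid

  Σ<-cong : ∀ n {f g : ℕ → Carrier} → (∀ k → k < n → f k ≈ g k) → Σ< n f ≈ Σ< n g
  Σ<-cong zero     f≈g = refl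
  Σ<-cong (suc n) f≈g =
    +-cong (Σ<-cong n (λ k k<n → f≈g k (m<n⇒m<1+n k<n))) (f≈g n (n<1+n n))

  Σ<-distrib-+ : ∀ n (f g : ℕ → Carrier) → Σ< n (λ k → f k + g k) ≈ Σ< n f + Σ< n g
  Σ<-distrib-+ zero    f g = sym (+-identityˡ 0#)
  Σ<-distrib-+ (suc n) f g = begin
    Σ< n (λ k → f k + g k) + (f n + g n) ≈⟨ +-congʳ (Σ<-distrib-+ n f g) ⟩
    (Σ< n f + Σ< n g) + (f n + g n)     ≈⟨ solve 4 (λ F G x y → (F ⊕ G) ⊕ (x ⊕ y) ⊜ (F ⊕ x) ⊕ (G ⊕ y))
                                                   refl (Σ< n f) (Σ< n g) (f n) (g n) ⟩
    (Σ< n f + f n) + (Σ< n g + g n)     ∎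

  Σ<-zero : ∀ n → Σ< n (λ _ → 0#) ≈ 0#
  Σ<-zero zero    = refl
  Σ<-zero (suc n) = trans (+-identityʳ _) (Σ<-zero n)

  Σ<-suc : ∀ n (f : ℕ → Carrier) → Σ< (suc n) f ≈ f 0 + Σ< n (λ k → f (suc k))
  Σ<-suc zero    f = +-comm 0# (f 0)
  Σ<-suc (suc n) f = trans (+-congʳ (Σ<-suc n f)) (+-assoc _ _ _)

  +-isolateˡ : ∀ {x y z w} → x + (y + z) ≈ w → x ≈ w - z - y
  +-isolateˡ {x} {y} {z} {w} sum≈w = sym (begin
    w - z - y               ≈⟨ +-congʳ (+-congʳ (sym sum≈w)) ⟩
    x + (y + z) - z - y     ≈⟨ +-congʳ (+-congʳ (sym (+-assoc x y z))) ⟩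
    (x + y) + z - z - y     ≈⟨ +-congʳ (//-rightDividesʳ z (x + y)) ⟩
    (x + y) - y             ≈⟨ //-rightDividesʳ y x ⟩
    x                       ∎)

  +-isolate-middle : ∀ {x y z w} → x + (y + z) ≈ w → y ≈ w - z - x
  +-isolate-middle {x} {y} {z} sum≈w = +-isolateˡ (trans (x∙yz≈y∙xz y x z) sum≈w)

  t-diagonal : b 0 ≈ a 0 → ∀ i → t i i ≈ b i
  t-diagonal b₀≈a₀ zero = sym b₀≈a₀
  t-diagonal b₀≈a₀ (suc i) with suc i ≟ suc i
  ... | yes _ = refl
  ... | no i≢i = ⊥-elim (i≢i ≡.refl)

  t-interior : ∀ {i j} → j < i → t (suc i) (suc j) ≡ - (t i j + t i (suc j))
  t-interior {i} {j} j<i with suc j ≟ suc i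
  ... | yes j≡i = ⊥-elim (<-irrefl (≡.cong pred j≡i) j<i)
  ... | no _ with suc j <? suc i
  ...   | yes _ = ≡.refl
  ...   | no j≮i = ⊥-elim (j≮i (s≤s j<i))

  t-zero-sum-weighted : ∀ {i j} (w : Carrier) → j < i →
    t (suc i) (suc j) * w + (t i j * w + t i (suc j) * w) ≈ 0#
  t-zero-sum-weighted {i} {j} w j<i rewrite t-interior j<i = begin
    - (t i j + t i (suc j)) * w + (t i j * w + t i (suc j) * w)
      ≈⟨ +-cong (sym (-‿distribˡ-* _ w)) (sym (distribʳ w _ _)) ⟩
    - ((t i j + t i (suc j)) * w) + (t i j + t i (suc j)) * w
      ≈⟨ -‿inverseˡ _ ⟩
    0# ∎

  rows-zero-sum : b 0 ≈ a 0 → ∀ i (w : ℕ → Carrier) →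
    Σ< (suc i) (λ k → t (suc i) (suc k) * w k)
      + (Σ< (suc i) (λ k → t i k * w k) + Σ< i (λ k → t i (suc k) * w k))
    ≈ w i * (b i + b (suc i))
  rows-zero-sum b₀≈a₀ i w = begin
    (ΣF + t (suc i) (suc i) * w i) + ((ΣG + t i i * w i) + ΣH)
      ≈⟨ +-cong (+-congˡ (*-congʳ (t-diagonal b₀≈a₀ (suc i))))
                (+-congʳ (+-congˡ (*-congʳ (t-diagonal b₀≈a₀ i)))) ⟩
    (ΣF + b (suc i) * w i) + ((ΣG + b i * w i) + ΣH)
      ≈⟨ solve 5 (λ F G H x y → (F ⊕ y) ⊕ ((G ⊕ x) ⊕ H) ⊜ (F ⊕ (G ⊕ H)) ⊕ (x ⊕ y))
                 refl ΣF ΣG ΣH (b i * w i) (b (suc i) * w i) ⟩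
    (ΣF + (ΣG + ΣH)) + (b i * w i + b (suc i) * w i)
      ≈⟨ +-cong interior-vanishes (trans (sym (distribʳ (w i) _ _)) (*-comm _ (w i))) ⟩
    0# + w i * (b i + b (suc i))
      ≈⟨ +-identityˡ _ ⟩
    w i * (b i + b (suc i)) ∎
    where
    F G H : ℕ → Carrier
    F k = t (suc i) (suc k) * w k
    G k = t i k * w k
    H k = t i (suc k) * w k
    ΣF = Σ< i F
    ΣG = Σ< i G
    ΣH = Σ< i H

    interior-vanishes : ΣF + (ΣG + ΣH) ≈ 0#
    interior-vanishes = begin
      ΣF + (ΣG + ΣH)                   ≈⟨ +-congˡ (Σ<-distrib-+ i G H) ⟨
      ΣF + Σ< i (λ k → G k + H k)      ≈⟨ Σ<-distrib-+ i F (λ k → G k + H k) ⟨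
      Σ< i (λ k → F k + (G k + H k))   ≈⟨ Σ<-cong i (λ k → t-zero-sum-weighted (w k)) ⟩
      Σ< i (λ _ → 0#)                  ≈⟨ Σ<-zero i ⟩
      0#                               ∎

  s₋₁-recurrence : b 0 ≈ a 0 → ∀ i → s₋₁ (suc i) + (s₀ i + s₋₁ i) ≈ a i * (b i + b (suc i))
  s₋₁-recurrence b₀≈a₀ i = rows-zero-sum b₀≈a₀ i a

  s₀-recurrence : b 0 ≈ a 0 → ∀ i →
    s₀ (suc i) + (s₁ i + s₀ i) ≈ a 0 * (a i + a (suc i)) + a (suc i) * (b i + b (suc i))
  s₀-recurrence b₀≈a₀ i = begin
    s₀ (suc i) + (s₁ i + s₀ i)
      ≈⟨ +-cong (Σ<-suc (suc i) _) (+-congˡ (Σ<-suc i _)) ⟩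
    (a (suc i) * a 0 + X) + (s₁ i + (a i * a 0 + Y))
      ≈⟨ solve 5 (λ u v X S Y → (v ⊕ X) ⊕ (S ⊕ (u ⊕ Y)) ⊜ (u ⊕ v) ⊕ (X ⊕ (S ⊕ Y)))
                 refl (a i * a 0) (a (suc i) * a 0) X (s₁ i) Y ⟩
    (a i * a 0 + a (suc i) * a 0) + (X + (s₁ i + Y))
      ≈⟨ +-cong (trans (sym (distribʳ (a 0) _ _)) (*-comm _ (a 0)))
                (rows-zero-sum b₀≈a₀ i (λ k → a (suc k))) ⟩
    a 0 * (a i + a (suc i)) + a (suc i) * (b i + b (suc i)) ∎
    where
    X = Σ< (suc i) (λ k → t (suc i) (suc k) * a (suc k))
    Y = Σ< i (λ k → t i (suc k) * a (suc k))

lemma2 : ∀ {c ℓ} (R : CommutativeRing c ℓ) (a b : ℕ → CommutativeRing.Carrier R) →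
  let open CommutativeRing R
      open ZeroSum R a b
  in b 0 ≈ a 0 →
     (s₀ 0 ≈ a 0 * a 0)
     × (s₁ 0 ≈ a 0 * a 1)
     × (s₋₁ 1 ≈ a 0 * b 1)
     × (∀ i → 2 ≤ i → s₋₁ i ≈ a (i ∸ 1) * (b (i ∸ 1) + b i) - s₋₁ (i ∸ 1) - s₀ (i ∸ 1))
     × (∀ i → 1 ≤ i → s₀ i ≈ a 0 * (a (i ∸ 1) + a i) + a i * (b (i ∸ 1) + b i) - s₀ (i ∸ 1) - s₁ (i ∸ 1))
     × (∀ i → 1 ≤ i → s₀ i ≈ a i * (b i + b (suc i)) - s₋₁ i - s₋₁ (suc i))
     × (∀ i → 1 ≤ i → s₁ i ≈ a 0 * (a i + a (suc i)) + a (suc i) * (b i + b (suc i)) - s₀ i - s₀ (suc i))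
lemma2 R a b b₀≈a₀ =
    +-identityˡ _
  , +-identityˡ _
  , trans (+-identityˡ _) (*-comm _ _)
  , (λ { (suc (suc i)) _ → +-isolateˡ (s₋₁-recurrence b₀≈a₀ (suc i)) ; (suc zero) (s≤s ()) })
  , (λ { (suc i) _ → +-isolateˡ (s₀-recurrence b₀≈a₀ i) })
  , (λ i _ → +-isolate-middle (s₋₁-recurrence b₀≈a₀ i))
  , (λ i _ → +-isolate-middle (s₀-recurrence b₀≈a₀ i))
  where
  open CommutativeRing R
  open ZeroSumProperties R a b
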